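{- Let $p=(123,\{2\},\emptyset)$ and $r=(132,\emptyset,\{2\})$. Then for every $n\ge 0$, \[|\mathrm{Av}_n(p,r)|=\sum_{k=0}^{n}\binom{\binom{k+1}{2}}{n-k}.\]
   Context: For $n\ge 0$, $\mathcal{S}_n$ is the set of permutations of $[n]=\{1,\dots,n\}$, written as words $\pi=\pi(1)\pi(2)\cdots\pi(n)$. Two words of distinct integers of the same length are order-isomorphic if their entries appear in the same relative order. A pattern of length 3 is a triple $(\sigma,X,Y)$ with $\sigma\in\mathcal{S}_3$ and $X,Y\subseteq\{1,2\}$. A permutation $\pi\in\mathcal{S}_n$ contains $(\sigma,X,Y)$ if there are indices $i_1<i_2<i_3$ such that $\pi(i_1)\pi(i_2)\pi(i_3)$ is order-isomorphic to $\sigma$, $i_{x+1}=i_x+1$ for every $x\in X$, and $j_{y+1}=j_y+1$ for every $y\in Y$, where $j_1<j_2<j_3$ are the three values $\pi(i_1),\pi(i_2),\pi(i_3)$ listed in increasing order; otherwise $\pi$ avoids it. For patterns $P_1,\dots,P_m$, $\mathrm{Av}_n(P_1,\dots,P_m)$ is the set of $\pi\in\mathcal{S}_n$ avoiding every $P_i$. -}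

module Defs where

open import Data.Nat using (ℕ; zero; suc; _+_; _∸_; _<ᵇ_; _≡ᵇ_)
open import Data.Nat.Combinatorics using (_C_)
open import Data.Bool using (Bool; true; false; _∧_; _∨_; not; _xor_; if_then_else_)
open import Data.Fin using (Fin; toℕ)
open import Data.Vec using (Vec; []; _∷_; lookup)
open import Data.List using (List; []; _∷_; map; concatMap; allFin; filterᵇ; length; upTo)
open import Data.Bool.ListAction using (all; any)
open import Data.Nat.ListAction using (sum)

-- Words of length n over the alphabet Fin n (values 0..n-1 encode 1..n).
words : ∀ {A : Set} → List A → (k : ℕ) → List (Vec A k)
words xs zero    = [] ∷ []
words xs (suc k) = concatMap (λ x → map (x ∷_) (words xs k)) xs

isPerm : ∀ {n} → Vec (Fin n) n → Bool
isPerm {n} π = all (λ i → all (λ j → (toℕ i ≡ᵇ toℕ j) ∨ not (toℕ (lookup π i) ≡ᵇ toℕ (lookup π j))) (allFin n)) (allFin n)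

perms : (n : ℕ) → List (Vec (Fin n) n)
perms n = filterᵇ isPerm (words (allFin n) n)

-- A length-3 pattern (σ, X, Y): σ ∈ S₃ as a word over Fin 3 (0,1,2 encode 1,2,3),
-- X, Y ⊆ {1,2} as characteristic functions on Fin 2 (zero ↦ 1, suc zero ↦ 2).
record Pattern : Set where
  constructor pat
  field
    σ : Vec (Fin 3) 3
    X : Fin 2 → Bool
    Y : Fin 2 → Bool

open Pattern

_⇒ᵇ_ : Bool → Bool → Bool
a ⇒ᵇ b = not a ∨ b

-- π contains (σ, X, Y) at positions i₁ < i₂ < i₃ (zero-based):
--  * π(i₁)π(i₂)π(i₃) is order-isomorphic to σ;
--  * for x ∈ X, i_{x+1} = i_x + 1;
--  * for y ∈ Y, j_{y+1} = j_y + 1 where j₁<j₂<j₃ are the values sorted.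
--    Given order-isomorphism, j_y is the entry π(i_a) with σ(a) = y, so this says:
--    whenever σ(b) = σ(a) + 1 = y + 1, then π(i_b) = π(i_a) + 1.
containsAt : ∀ {n} → Vec (Fin n) n → Pattern → Fin n → Fin n → Fin n → Bool
containsAt π (pat σ X Y) i₁ i₂ i₃ =
  (toℕ i₁ <ᵇ toℕ i₂) ∧ (toℕ i₂ <ᵇ toℕ i₃) ∧ orderIso ∧ posAdj ∧ valAdj
  where
  idx : Fin 3 → ℕ
  idx Fin.zero = toℕ i₁
  idx (Fin.suc Fin.zero) = toℕ i₂
  idx (Fin.suc (Fin.suc Fin.zero)) = toℕ i₃
  val : Fin 3 → ℕ
  val Fin.zero = toℕ (lookup π i₁)
  val (Fin.suc Fin.zero) = toℕ (lookup π i₂)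
  val (Fin.suc (Fin.suc Fin.zero)) = toℕ (lookup π i₃)
  s : Fin 3 → ℕ
  s a = toℕ (lookup σ a)
  orderIso = all (λ a → all (λ b → not ((val a <ᵇ val b) xor (s a <ᵇ s b))) (allFin 3)) (allFin 3)
  posAdj = (X Fin.zero ⇒ᵇ (idx (Fin.suc Fin.zero) ≡ᵇ suc (idx Fin.zero)))
         ∧ (X (Fin.suc Fin.zero) ⇒ᵇ (idx (Fin.suc (Fin.suc Fin.zero)) ≡ᵇ suc (idx (Fin.suc Fin.zero))))
  valAdj = all (λ y → Y y ⇒ᵇ all (λ a → all (λ b →
             ((s a ≡ᵇ toℕ y) ∧ (s b ≡ᵇ suc (toℕ y))) ⇒ᵇ (val b ≡ᵇ suc (val a)))
             (allFin 3)) (allFin 3)) (allFin 2)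

contains : ∀ {n} → Vec (Fin n) n → Pattern → Bool
contains {n} π P = any (λ i₁ → any (λ i₂ → any (λ i₃ → containsAt π P i₁ i₂ i₃) (allFin n)) (allFin n)) (allFin n)

avoidsAll : ∀ {n} → Vec (Fin n) n → List Pattern → Bool
avoidsAll π Ps = all (λ P → not (contains π P)) Ps

Av : (n : ℕ) → List Pattern → List (Vec (Fin n) n)
Av n Ps = filterᵇ (λ π → avoidsAll π Ps) (perms n)

f0 f1 f2 : Fin 3
f0 = Fin.zero
f1 = Fin.suc Fin.zero
f2 = Fin.suc (Fin.suc Fin.zero)

p : Pattern
p = pat (f0 ∷ f1 ∷ f2 ∷ []) (λ { Fin.zero → false ; (Fin.suc Fin.zero) → true }) (λ _ → false)

r : Pattern
r = pat (f0 ∷ f2 ∷ f1 ∷ []) (λ _ → false) (λ { Fin.zero → false ; (Fin.suc Fin.zero) → true })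

rhs : ℕ → ℕ
rhs n = sum (map (λ k → ((suc k) C 2) C (n ∸ k)) (upTo (suc n)))

-- Every permutation of [n+1] arises exactly
-- once by inserting the maximum n into a permutation of [n], and deleting the maximum cannot
-- create an occurrence of p or r, so the avoiders form a generating tree.  Inserting n into an
-- avoider keeps it avoiding exactly when n goes in front, or directly after a left-to-right
-- minimum that is not to the left of the old maximum n − 1: otherwise n forms a p with the
-- entry before it and a smaller earlier entry, or an r with a smaller earlier entry and n − 1.
-- Labelling an avoider by (L, m), the number of its left-to-right minima and the number of
-- those not to the left of its maximum, the children of (L, m) are (L+1, L+1), (L, m−1), …,
-- (L, 0).  By the hockey-stick identity the number of nodes at depth t below (L, m) is
-- Σ_{d+k=t} C(m + (L+1) + ⋯ + (L+d), k), which at the root (0, 0) is Σ_k C(C(k+1, 2), n−k).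

module Submission where

open import Defs
open import Algebra.Bundles using (CommutativeMonoid)
open import Data.Bool using (Bool; true; false; _∧_; _∨_; not; _xor_; if_then_else_; T)
open import Data.Bool.ListAction using (all; any)
open import Data.Bool.Properties
  using (∧-conicalˡ; ∧-conicalʳ; ∧-identityʳ; ∧-zeroʳ; ∨-assoc; ∨-comm; ∨-identityʳ; ∨-zeroʳ;
         ∨-commutativeMonoid; not-involutive; ⇔→≡)
open import Data.Empty using (⊥-elim)
open import Data.Fin using (Fin; toℕ; fromℕ<)
open import Data.Fin.Patterns using (0F; 1F; 2F)
import Data.Fin.Properties as Fin
open import Data.List
  using (List; []; _∷_; _++_; [_]; map; concat; concatMap; foldl; length; allFin; filterᵇ; downFrom; upTo; applyUpTo)
import Data.List.Properties as List
open import Data.List.Membership.Propositional using (_∈_; find; lose)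
import Data.List.Membership.Propositional.Properties as ∈
open import Data.List.Membership.Propositional.Properties.WithK using (unique∧set⇒bag)
open import Data.List.Relation.Binary.BagAndSetEquality using (∼bag⇒↭)
open import Data.List.Relation.Binary.Permutation.Propositional using (_↭_; ↭-sym; ↭⇒↭ₛ)
import Data.List.Relation.Binary.Permutation.Propositional.Properties as ↭
import Data.List.Relation.Binary.Permutation.Setoid.Properties as PermutationSetoid
open import Data.List.Relation.Unary.All as All using (All; []; _∷_)
import Data.List.Relation.Unary.All.Properties as All
open import Data.List.Relation.Unary.AllPairs using ([]; _∷_)
open import Data.List.Relation.Unary.Any using (here; there)
open import Data.List.Relation.Unary.Unique.Propositional using (Unique)
import Data.List.Relation.Unary.Unique.Propositional.Properties as Unique
open import Data.Nat using (ℕ; zero; suc; _+_; _∸_; _⊓_; _<_; _≤_; _<ᵇ_; _≡ᵇ_; z≤n; s≤s)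
open import Data.Nat.Combinatorics using (_C_; nC1≡n; nCk+nC[k+1]≡[n+1]C[k+1])
open import Data.Nat.ListAction using (sum)
open import Data.Nat.ListAction.Properties using (sum-++)
open import Data.Nat.Properties
open import Data.Nat.Tactic.RingSolver using (solve-∀)
open import Algebra.Properties.CommutativeSemigroup
  (CommutativeMonoid.commutativeSemigroup ∨-commutativeMonoid) using () renaming (interchange to ∨-interchange)
open import Algebra.Properties.CommutativeSemigroup +-commutativeSemigroup
  using () renaming (interchange to +-interchange; x∙yz≈y∙xz to +-leftComm)
open import Data.List.Membership.DecPropositional _≟_ using (_∈?_)
open import Data.Product using (∃₂; ∃-syntax; _×_; _,_; proj₁; proj₂)
open import Data.Sum using (_⊎_; inj₁; inj₂)
open import Data.Vec using (Vec; []; _∷_; lookup; toList)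
import Data.Vec as Vec
import Data.Vec.Properties as Vec
open import Function using (_∘_; mk⇔; case_of_)
open import Relation.Nullary using (¬_; yes; no)
open import Relation.Nullary.Decidable using (T?)
open import Relation.Binary.PropositionalEquality hiding ([_])
open ≡-Reasoning

∧-true⁻ : ∀ {a b} → a ∧ b ≡ true → a ≡ true × b ≡ true
∧-true⁻ h = ∧-conicalˡ _ _ h , ∧-conicalʳ _ _ h

∨-true⁻ : ∀ {a b} → a ∨ b ≡ true → a ≡ true ⊎ b ≡ true
∨-true⁻ {true}  _ = inj₁ refl
∨-true⁻ {false} h = inj₂ h

∨-trueˡ : ∀ {a} b → a ≡ true → a ∨ b ≡ true
∨-trueˡ b refl = refl

∨-trueʳ : ∀ a {b} → b ≡ true → a ∨ b ≡ true
∨-trueʳ true  _ = refl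
∨-trueʳ false h = h

not-xor-true⁻ : ∀ a b → not (a xor b) ≡ true → a ≡ b
not-xor-true⁻ true  true  _ = refl
not-xor-true⁻ false false _ = refl

not-xor-true⁺ : ∀ {a b} → a ≡ b → not (a xor b) ≡ true
not-xor-true⁺ {true}  refl = refl
not-xor-true⁺ {false} refl = refl

T⇒≡true : ∀ {b} → T b → b ≡ true
T⇒≡true {true} _ = refl

≡true⇒T : ∀ {b} → b ≡ true → T b
≡true⇒T refl = _

<ᵇ-true : ∀ {m n} → m < n → (m <ᵇ n) ≡ true
<ᵇ-true m<n = T⇒≡true (<⇒<ᵇ m<n)

<ᵇ-true⁻ : ∀ {m n} → (m <ᵇ n) ≡ true → m < n
<ᵇ-true⁻ h = <ᵇ⇒< _ _ (≡true⇒T h)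

<ᵇ-false : ∀ {m n} → n ≤ m → (m <ᵇ n) ≡ false
<ᵇ-false {m} {n} n≤m with m <ᵇ n in eq
... | false = refl
... | true  = ⊥-elim (<⇒≱ (<ᵇ-true⁻ eq) n≤m)

<ᵇ-false⁻ : ∀ {m n} → (m <ᵇ n) ≡ false → n ≤ m
<ᵇ-false⁻ h = ≮⇒≥ λ m<n → case trans (sym (<ᵇ-true m<n)) h of λ ()

≡ᵇ-true : ∀ {m n} → m ≡ n → (m ≡ᵇ n) ≡ true
≡ᵇ-true m≡n = T⇒≡true (≡⇒≡ᵇ _ _ m≡n)

≡ᵇ-true⁻ : ∀ {m n} → (m ≡ᵇ n) ≡ true → m ≡ n
≡ᵇ-true⁻ h = ≡ᵇ⇒≡ _ _ (≡true⇒T h)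

≡ᵇ-false : ∀ {m n} → m ≢ n → (m ≡ᵇ n) ≡ false
≡ᵇ-false {m} {n} m≢n with m ≡ᵇ n in eq
... | false = refl
... | true  = ⊥-elim (m≢n (≡ᵇ-true⁻ eq))

module _ {A : Set} (f : A → Bool) where

  all-true⁻ : ∀ {xs} → all f xs ≡ true → ∀ {x} → x ∈ xs → f x ≡ true
  all-true⁻ {x ∷ _} h (here refl) = proj₁ (∧-true⁻ {f x} h)
  all-true⁻ {x ∷ _} h (there x∈) = all-true⁻ (proj₂ (∧-true⁻ {f x} h)) x∈

  all-true⁺ : ∀ xs → (∀ {x} → x ∈ xs → f x ≡ true) → all f xs ≡ true
  all-true⁺ []       _ = refl
  all-true⁺ (x ∷ xs) h = cong₂ _∧_ (h (here refl)) (all-true⁺ xs (h ∘ there))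

  any-true⁻ : ∀ xs → any f xs ≡ true → ∃[ x ] x ∈ xs × f x ≡ true
  any-true⁻ (x ∷ xs) h with ∨-true⁻ {f x} h
  ... | inj₁ fx = x , here refl , fx
  ... | inj₂ h′ with any-true⁻ xs h′
  ...   | y , y∈ , fy = y , there y∈ , fy

  any-true⁺ : ∀ {xs x} → x ∈ xs → f x ≡ true → any f xs ≡ true
  any-true⁺ {x ∷ _}  (here refl) fx = ∨-trueˡ _ fx
  any-true⁺ {y ∷ _}  (there x∈)  fx = ∨-trueʳ (f y) (any-true⁺ x∈ fx)

  any-false⁺ : ∀ xs → (∀ {x} → x ∈ xs → f x ≡ false) → any f xs ≡ false
  any-false⁺ []       _ = refl
  any-false⁺ (x ∷ xs) h = cong₂ _∨_ (h (here refl)) (any-false⁺ xs (h ∘ there))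

-- The patterns p and r on lists of values

agreesAt : Vec (Fin 3) 3 → Vec ℕ 3 → Fin 3 → Fin 3 → Bool
agreesAt σ v a b = not ((lookup v a <ᵇ lookup v b) xor (toℕ (lookup σ a) <ᵇ toℕ (lookup σ b)))

orderIsoᵇ : Vec (Fin 3) 3 → Vec ℕ 3 → Bool
orderIsoᵇ σ v = all (λ a → all (agreesAt σ v a) (allFin 3)) (allFin 3)

SameOrder : Vec (Fin 3) 3 → Vec ℕ 3 → Set
SameOrder σ v = ∀ a b → (lookup v a <ᵇ lookup v b) ≡ (toℕ (lookup σ a) <ᵇ toℕ (lookup σ b))

orderIsoᵇ⁻ : ∀ {σ v} → orderIsoᵇ σ v ≡ true → SameOrder σ v
orderIsoᵇ⁻ {σ} {v} h a b = not-xor-true⁻ _ _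
  (all-true⁻ (agreesAt σ v a) (all-true⁻ (λ a → all (agreesAt σ v a) (allFin 3)) h (∈.∈-allFin a)) (∈.∈-allFin b))

orderIsoᵇ⁺ : ∀ {σ v} → SameOrder σ v → orderIsoᵇ σ v ≡ true
orderIsoᵇ⁺ {σ} {v} same = all-true⁺ (λ a → all (agreesAt σ v a) (allFin 3)) (allFin 3) λ {a} _ →
  all-true⁺ (agreesAt σ v a) (allFin 3) λ {b} _ → not-xor-true⁺ (same a b)

sameOrder-123 : ∀ {x y z} → x < y → y < z → SameOrder (Pattern.σ p) (x ∷ y ∷ z ∷ [])
sameOrder-123 {x} {y} {z} x<y y<z = λ where
  0F 0F → <ᵇ-false {x} ≤-refl
  0F 1F → <ᵇ-true x<y
  0F 2F → <ᵇ-true (<-trans x<y y<z)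
  1F 0F → <ᵇ-false (<⇒≤ x<y)
  1F 1F → <ᵇ-false {y} ≤-refl
  1F 2F → <ᵇ-true y<z
  2F 0F → <ᵇ-false (<⇒≤ (<-trans x<y y<z))
  2F 1F → <ᵇ-false (<⇒≤ y<z)
  2F 2F → <ᵇ-false {z} ≤-refl

sameOrder-132 : ∀ {x y z} → x < z → z < y → SameOrder (Pattern.σ r) (x ∷ y ∷ z ∷ [])
sameOrder-132 {x} {y} {z} x<z z<y = λ where
  0F 0F → <ᵇ-false {x} ≤-refl
  0F 1F → <ᵇ-true (<-trans x<z z<y)
  0F 2F → <ᵇ-true x<z
  1F 0F → <ᵇ-false (<⇒≤ (<-trans x<z z<y))
  1F 1F → <ᵇ-false {y} ≤-refl
  1F 2F → <ᵇ-false (<⇒≤ z<y)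
  2F 0F → <ᵇ-false (<⇒≤ x<z)
  2F 1F → <ᵇ-true z<y
  2F 2F → <ᵇ-false {z} ≤-refl

module _ {n} (π : Vec (Fin n) n) (i j k : Fin n) where
  private
    v : Fin n → ℕ
    v x = toℕ (lookup π x)
    vs : Vec ℕ 3
    vs = v i ∷ v j ∷ v k ∷ []

  -- The trailing `∧ true`s are the vacuous adjacency constraints of p and r.
  containsAt-p≡ : containsAt π p i j k ≡
    (toℕ i <ᵇ toℕ j) ∧ (toℕ j <ᵇ toℕ k) ∧ orderIsoᵇ (Pattern.σ p) vs ∧ (toℕ k ≡ᵇ suc (toℕ j)) ∧ true
  containsAt-p≡ = refl

  containsAt-p⁻ : containsAt π p i j k ≡ true →
    toℕ i < toℕ j × toℕ k ≡ suc (toℕ j) × v i < v j × v j < v k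
  containsAt-p⁻ h
    with i<j , h₁ ← ∧-true⁻ {toℕ i <ᵇ toℕ j} (trans (sym containsAt-p≡) h)
    with _ , h₂ ← ∧-true⁻ {toℕ j <ᵇ toℕ k} h₁
    with iso , h₃ ← ∧-true⁻ {orderIsoᵇ (Pattern.σ p) vs} h₂
    with adj , _ ← ∧-true⁻ {toℕ k ≡ᵇ suc (toℕ j)} h₃
    = <ᵇ-true⁻ i<j , ≡ᵇ-true⁻ adj , <ᵇ-true⁻ (same 0F 1F) , <ᵇ-true⁻ (same 1F 2F)
    where same = orderIsoᵇ⁻ {Pattern.σ p} {vs} iso

  containsAt-p⁺ : toℕ i < toℕ j → toℕ k ≡ suc (toℕ j) → v i < v j → v j < v k →
    containsAt π p i j k ≡ true
  containsAt-p⁺ i<j adj x<y y<z = trans containsAt-p≡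
    (cong₂ _∧_ (<ᵇ-true i<j) (cong₂ _∧_ (<ᵇ-true (subst (toℕ j <_) (sym adj) (n<1+n _)))
      (cong₂ _∧_ (orderIsoᵇ⁺ {Pattern.σ p} {vs} (sameOrder-123 x<y y<z)) (cong₂ _∧_ (≡ᵇ-true adj) refl))))

  containsAt-r≡ : containsAt π r i j k ≡
    (toℕ i <ᵇ toℕ j) ∧ (toℕ j <ᵇ toℕ k) ∧ orderIsoᵇ (Pattern.σ r) vs ∧ (((v j ≡ᵇ suc (v k)) ∧ true) ∧ true) ∧ true
  containsAt-r≡ = refl

  containsAt-r⁻ : containsAt π r i j k ≡ true →
    toℕ i < toℕ j × toℕ j < toℕ k × v i < v k × v j ≡ suc (v k)
  containsAt-r⁻ h
    with i<j , h₁ ← ∧-true⁻ {toℕ i <ᵇ toℕ j} (trans (sym containsAt-r≡) h)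
    with j<k , h₂ ← ∧-true⁻ {toℕ j <ᵇ toℕ k} h₁
    with iso , h₃ ← ∧-true⁻ {orderIsoᵇ (Pattern.σ r) vs} h₂
    = <ᵇ-true⁻ i<j , <ᵇ-true⁻ j<k , <ᵇ-true⁻ (orderIsoᵇ⁻ {Pattern.σ r} {vs} iso 0F 2F) , ≡ᵇ-true⁻ adj
    where adj = proj₁ (∧-true⁻ (proj₁ (∧-true⁻ (proj₁ (∧-true⁻ h₃)))))

  containsAt-r⁺ : toℕ i < toℕ j → toℕ j < toℕ k → v i < v k → v j ≡ suc (v k) →
    containsAt π r i j k ≡ true
  containsAt-r⁺ i<j j<k x<z adj = trans containsAt-r≡
    (cong₂ _∧_ (<ᵇ-true i<j) (cong₂ _∧_ (<ᵇ-true j<k)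
      (cong₂ _∧_ (orderIsoᵇ⁺ {Pattern.σ r} {vs} (sameOrder-132 x<z (subst (v k <_) (sym adj) (n<1+n _))))
        (cong₂ _∧_ (cong₂ _∧_ (cong₂ _∧_ (≡ᵇ-true adj) refl) refl) refl))))

riseAbove : ℕ → List ℕ → Bool
riseAbove x []          = false
riseAbove x (a ∷ [])    = false
riseAbove x (a ∷ b ∷ ℓ) = ((x <ᵇ a) ∧ (a <ᵇ b)) ∨ riseAbove x (b ∷ ℓ)

containsP : List ℕ → Bool
containsP []      = false
containsP (x ∷ ℓ) = riseAbove x ℓ ∨ containsP ℓ

isPredAbove : ℕ → ℕ → ℕ → Bool
isPredAbove x b a = (x <ᵇ a) ∧ (suc a ≡ᵇ b)

inversionAbove : ℕ → List ℕ → Bool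
inversionAbove x []      = false
inversionAbove x (b ∷ ℓ) = any (isPredAbove x b) ℓ ∨ inversionAbove x ℓ

containsR : List ℕ → Bool
containsR []      = false
containsR (x ∷ ℓ) = inversionAbove x ℓ ∨ containsR ℓ

avoidsPR : List ℕ → Bool
avoidsPR ℓ = not (containsP ℓ) ∧ not (containsR ℓ)

module _ {m} (w : Vec ℕ m) where

  RiseAbove : ℕ → Set
  RiseAbove x = ∃[ j ] ∃[ k ] toℕ k ≡ suc (toℕ j) × x < lookup w j × lookup w j < lookup w k

  OccursP : Set
  OccursP = ∃[ i ] ∃[ j ] ∃[ k ]
    toℕ i < toℕ j × toℕ k ≡ suc (toℕ j) × lookup w i < lookup w j × lookup w j < lookup w k

  InversionAbove : ℕ → Set
  InversionAbove x = ∃[ j ] ∃[ k ] toℕ j < toℕ k × x < lookup w k × lookup w j ≡ suc (lookup w k)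

  OccursR : Set
  OccursR = ∃[ i ] ∃[ j ] ∃[ k ]
    toℕ i < toℕ j × toℕ j < toℕ k × lookup w i < lookup w k × lookup w j ≡ suc (lookup w k)

riseAbove-∷⁻ : ∀ {m} x a (w : Vec ℕ m) → riseAbove x (a ∷ toList w) ≡ true → RiseAbove (a ∷ w) x
riseAbove-∷⁻ x a (b ∷ w) h with ∨-true⁻ {(x <ᵇ a) ∧ (a <ᵇ b)} h
... | inj₁ first = 0F , 1F , refl , <ᵇ-true⁻ (proj₁ (∧-true⁻ first)) , <ᵇ-true⁻ (proj₂ (∧-true⁻ first))
... | inj₂ later with riseAbove-∷⁻ x b w later
...   | j , k , adj , x<wj , wj<wk = Fin.suc j , Fin.suc k , cong suc adj , x<wj , wj<wk

riseAbove-∷⁺ : ∀ {m} x a (w : Vec ℕ m) → RiseAbove (a ∷ w) x → riseAbove x (a ∷ toList w) ≡ true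
riseAbove-∷⁺ x a (b ∷ w) (0F , 1F , _ , x<a , a<b) =
  ∨-trueˡ _ (cong₂ _∧_ (<ᵇ-true x<a) (<ᵇ-true a<b))
riseAbove-∷⁺ x a (b ∷ w) (Fin.suc j , Fin.suc k , adj , x<wj , wj<wk) =
  ∨-trueʳ _ (riseAbove-∷⁺ x b w (j , k , suc-injective adj , x<wj , wj<wk))
riseAbove-∷⁺ x a []      (0F , 0F , () , _)
riseAbove-∷⁺ x a (b ∷ w) (0F , 0F , () , _)
riseAbove-∷⁺ x a (b ∷ w) (0F , Fin.suc (Fin.suc k) , () , _)
riseAbove-∷⁺ x a (b ∷ w) (Fin.suc j , 0F , () , _)

riseAbove⁻ : ∀ {m} x (w : Vec ℕ m) → riseAbove x (toList w) ≡ true → RiseAbove w x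
riseAbove⁻ x (a ∷ w) = riseAbove-∷⁻ x a w

riseAbove⁺ : ∀ {m} x (w : Vec ℕ m) → RiseAbove w x → riseAbove x (toList w) ≡ true
riseAbove⁺ x []      (() , _)
riseAbove⁺ x (a ∷ w) = riseAbove-∷⁺ x a w

containsP⁻ : ∀ {m} (w : Vec ℕ m) → containsP (toList w) ≡ true → OccursP w
containsP⁻ (x ∷ w) h with ∨-true⁻ {riseAbove x (toList w)} h
... | inj₁ first with riseAbove⁻ x w first
...   | j , k , adj , l₁ , l₂ = 0F , Fin.suc j , Fin.suc k , s≤s z≤n , cong suc adj , l₁ , l₂
containsP⁻ (x ∷ w) h | inj₂ later with containsP⁻ w later
...   | i , j , k , i<j , adj , l₁ , l₂ = Fin.suc i , Fin.suc j , Fin.suc k , s≤s i<j , cong suc adj , l₁ , l₂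

containsP⁺ : ∀ {m} (w : Vec ℕ m) → OccursP w → containsP (toList w) ≡ true
containsP⁺ (x ∷ a ∷ w) (0F , Fin.suc j , Fin.suc k , _ , adj , l₁ , l₂) =
  ∨-trueˡ _ (riseAbove-∷⁺ x a w (j , k , suc-injective adj , l₁ , l₂))
containsP⁺ (x ∷ w) (Fin.suc i , Fin.suc j , Fin.suc k , s≤s i<j , adj , l₁ , l₂) =
  ∨-trueʳ (riseAbove x (toList w)) (containsP⁺ w (i , j , k , i<j , suc-injective adj , l₁ , l₂))
containsP⁺ (x ∷ w) (0F , 0F , _ , () , _)
containsP⁺ (x ∷ w) (0F , Fin.suc j , 0F , _ , () , _)
containsP⁺ (x ∷ w) (Fin.suc i , 0F , _ , () , _)
containsP⁺ (x ∷ w) (Fin.suc i , Fin.suc j , 0F , _ , () , _)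

any-toList⁻ : ∀ {m} (f : ℕ → Bool) (w : Vec ℕ m) → any f (toList w) ≡ true → ∃[ k ] f (lookup w k) ≡ true
any-toList⁻ f (x ∷ w) h with ∨-true⁻ {f x} h
... | inj₁ fx = 0F , fx
... | inj₂ later with any-toList⁻ f w later
...   | k , fk = Fin.suc k , fk

any-toList⁺ : ∀ {m} (f : ℕ → Bool) (w : Vec ℕ m) k → f (lookup w k) ≡ true → any f (toList w) ≡ true
any-toList⁺ f (x ∷ w) 0F        fx = ∨-trueˡ _ fx
any-toList⁺ f (x ∷ w) (Fin.suc k) fk = ∨-trueʳ (f x) (any-toList⁺ f w k fk)

inversionAbove⁻ : ∀ {m} x (w : Vec ℕ m) → inversionAbove x (toList w) ≡ true → InversionAbove w x
inversionAbove⁻ x (b ∷ w) h with ∨-true⁻ {any (isPredAbove x b) (toList w)} h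
... | inj₁ first with any-toList⁻ (isPredAbove x b) w first
...   | k , pk = 0F , Fin.suc k , s≤s z≤n , <ᵇ-true⁻ (proj₁ (∧-true⁻ pk)) , sym (≡ᵇ-true⁻ (proj₂ (∧-true⁻ pk)))
inversionAbove⁻ x (b ∷ w) h | inj₂ later with inversionAbove⁻ x w later
...   | j , k , j<k , l , adj = Fin.suc j , Fin.suc k , s≤s j<k , l , adj

inversionAbove⁺ : ∀ {m} x (w : Vec ℕ m) → InversionAbove w x → inversionAbove x (toList w) ≡ true
inversionAbove⁺ x (b ∷ w) (0F , Fin.suc k , _ , l , adj) =
  ∨-trueˡ _ (any-toList⁺ (isPredAbove x b) w k (cong₂ _∧_ (<ᵇ-true l) (≡ᵇ-true (sym adj))))
inversionAbove⁺ x (b ∷ w) (Fin.suc j , Fin.suc k , s≤s j<k , l , adj) =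
  ∨-trueʳ (any (isPredAbove x b) (toList w)) (inversionAbove⁺ x w (j , k , j<k , l , adj))
inversionAbove⁺ x (b ∷ w) (0F , 0F , () , _)
inversionAbove⁺ x (b ∷ w) (Fin.suc j , 0F , () , _)

containsR⁻ : ∀ {m} (w : Vec ℕ m) → containsR (toList w) ≡ true → OccursR w
containsR⁻ (x ∷ w) h with ∨-true⁻ {inversionAbove x (toList w)} h
... | inj₁ first with inversionAbove⁻ x w first
...   | j , k , j<k , l , adj = 0F , Fin.suc j , Fin.suc k , s≤s z≤n , s≤s j<k , l , adj
containsR⁻ (x ∷ w) h | inj₂ later with containsR⁻ w later
...   | i , j , k , i<j , j<k , l , adj = Fin.suc i , Fin.suc j , Fin.suc k , s≤s i<j , s≤s j<k , l , adj

containsR⁺ : ∀ {m} (w : Vec ℕ m) → OccursR w → containsR (toList w) ≡ true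
containsR⁺ (x ∷ w) (0F , Fin.suc j , Fin.suc k , _ , s≤s j<k , l , adj) =
  ∨-trueˡ _ (inversionAbove⁺ x w (j , k , j<k , l , adj))
containsR⁺ (x ∷ w) (Fin.suc i , Fin.suc j , Fin.suc k , s≤s i<j , s≤s j<k , l , adj) =
  ∨-trueʳ (inversionAbove x (toList w)) (containsR⁺ w (i , j , k , i<j , j<k , l , adj))
containsR⁺ (x ∷ w) (0F , 0F , _ , () , _)
containsR⁺ (x ∷ w) (0F , Fin.suc j , 0F , _ , () , _)
containsR⁺ (x ∷ w) (Fin.suc i , 0F , _ , () , _)
containsR⁺ (x ∷ w) (Fin.suc i , Fin.suc j , 0F , _ , () , _)

values : ∀ {n m} → Vec (Fin n) m → List ℕ
values π = toList (Vec.map toℕ π)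

module _ {n} (π : Vec (Fin n) n) where

  contains⁻ : ∀ P → contains π P ≡ true → ∃[ i ] ∃[ j ] ∃[ k ] containsAt π P i j k ≡ true
  contains⁻ P h =
    let i , _ , hi = any-true⁻ _ (allFin n) h
        j , _ , hj = any-true⁻ _ (allFin n) hi
        k , _ , hk = any-true⁻ _ (allFin n) hj
    in i , j , k , hk

  contains⁺ : ∀ P i j k → containsAt π P i j k ≡ true → contains π P ≡ true
  contains⁺ P i j k h =
    any-true⁺ _ (∈.∈-allFin i) (any-true⁺ _ (∈.∈-allFin j) (any-true⁺ (containsAt π P i j) (∈.∈-allFin k) h))

  private
    w = Vec.map toℕ π
    lookup-w : ∀ i → lookup w i ≡ toℕ (lookup π i)
    lookup-w i = Vec.lookup-map i toℕ π

  contains-p≡containsP : contains π p ≡ containsP (values π)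
  contains-p≡containsP = ⇔→≡ {z = true} (mk⇔ to from)
    where
    to : contains π p ≡ true → containsP (values π) ≡ true
    to h with i , j , k , hk ← contains⁻ p h with containsAt-p⁻ π i j k hk
    ... | i<j , adj , l₁ , l₂ = containsP⁺ w (i , j , k , i<j , adj ,
      subst₂ _<_ (sym (lookup-w i)) (sym (lookup-w j)) l₁ , subst₂ _<_ (sym (lookup-w j)) (sym (lookup-w k)) l₂)
    from : containsP (values π) ≡ true → contains π p ≡ true
    from h with i , j , k , i<j , adj , l₁ , l₂ ← containsP⁻ w h = contains⁺ p i j k
      (containsAt-p⁺ π i j k i<j adj (subst₂ _<_ (lookup-w i) (lookup-w j) l₁) (subst₂ _<_ (lookup-w j) (lookup-w k) l₂))

  contains-r≡containsR : contains π r ≡ containsR (values π)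
  contains-r≡containsR = ⇔→≡ {z = true} (mk⇔ to from)
    where
    to : contains π r ≡ true → containsR (values π) ≡ true
    to h with i , j , k , hk ← contains⁻ r h with containsAt-r⁻ π i j k hk
    ... | i<j , j<k , l , adj = containsR⁺ w (i , j , k , i<j , j<k ,
      subst₂ _<_ (sym (lookup-w i)) (sym (lookup-w k)) l , trans (lookup-w j) (trans adj (cong suc (sym (lookup-w k)))))
    from : containsR (values π) ≡ true → contains π r ≡ true
    from h with i , j , k , i<j , j<k , l , adj ← containsR⁻ w h = contains⁺ r i j k
      (containsAt-r⁺ π i j k i<j j<k (subst₂ _<_ (lookup-w i) (lookup-w k) l)
        (trans (sym (lookup-w j)) (trans adj (cong suc (lookup-w k)))))

  avoidsAll≡avoidsPR : avoidsAll π (p ∷ r ∷ []) ≡ avoidsPR (values π)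
  avoidsAll≡avoidsPR rewrite contains-p≡containsP | contains-r≡containsR =
    cong (not (containsP (values π)) ∧_) (∧-identityʳ _)

-- Permutations as lists of values, generated by inserting the maximum

↭-fromUniqueSameElements : ∀ {A : Set} {xs ys : List A} → Unique xs → Unique ys →
  (∀ {x} → x ∈ xs → x ∈ ys) → (∀ {x} → x ∈ ys → x ∈ xs) → xs ↭ ys
↭-fromUniqueSameElements ux uy xs⊆ys ys⊆xs = ∼bag⇒↭ (unique∧set⇒bag ux uy (mk⇔ xs⊆ys ys⊆xs))

Unique-concatMap⁺ : ∀ {A B : Set} (f : A → List B) (g : B → A) {xs : List A} →
  (∀ {x y} → x ∈ xs → y ∈ f x → g y ≡ x) → Unique xs →
  (∀ {x} → x ∈ xs → Unique (f x)) → Unique (concatMap f xs)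
Unique-concatMap⁺ f g {[]}     _    _          _ = []
Unique-concatMap⁺ f g {x ∷ xs} left (x∉xs ∷ u) uf =
  Unique.++⁺ (uf (here refl)) (Unique-concatMap⁺ f g (left ∘ there) u (uf ∘ there)) disjoint
  where
  disjoint : ∀ {y} → ¬ (y ∈ f x × y ∈ concatMap f xs)
  disjoint (y∈fx , y∈rest) with x′ , x′∈xs , y∈fx′ ← find (∈.∈-concatMap⁻ f {xs = xs} y∈rest) =
    All.lookup x∉xs x′∈xs (trans (sym (left (here refl) y∈fx)) (left (there x′∈xs) y∈fx′))

record IsPermutation (n : ℕ) (ℓ : List ℕ) : Set where
  constructor isPermutation
  field
    unique  : Unique ℓ
    bounded : All (_< n) ℓ
    length≡ : length ℓ ≡ n

words-unique : ∀ {A : Set} {xs : List A} → Unique xs → ∀ k → Unique (words xs k)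
words-unique ux zero    = [] ∷ []
words-unique {xs = xs} ux (suc k) =
  Unique-concatMap⁺ (λ x → map (x ∷_) (words xs k)) Vec.head headOf ux
    (λ _ → Unique.map⁺ Vec.∷-injectiveʳ (words-unique ux k))
  where
  headOf : ∀ {x w} → x ∈ xs → w ∈ map (x ∷_) (words xs k) → Vec.head w ≡ x
  headOf _ w∈ with _ , _ , refl ← ∈.∈-map⁻ _ w∈ = refl

∈-words : ∀ {n} k (ℓ : List ℕ) → All (_< n) ℓ → length ℓ ≡ k →
  ∃[ w ] w ∈ words (allFin n) k × values w ≡ ℓ
∈-words zero [] [] refl = [] , here refl , refl
∈-words {n} (suc k) (x ∷ ℓ) (x<n ∷ ℓ<n) refl with w , w∈ , w≡ℓ ← ∈-words k ℓ ℓ<n refl =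
  fromℕ< x<n ∷ w ,
  ∈.∈-concatMap⁺ (λ y → map (y ∷_) (words (allFin n) k)) (lose (∈.∈-allFin (fromℕ< x<n)) (∈.∈-map⁺ _ w∈)) ,
  cong₂ _∷_ (Fin.toℕ-fromℕ< x<n) w≡ℓ

values-injective : ∀ {n m} {π π′ : Vec (Fin n) m} → values π ≡ values π′ → π ≡ π′
values-injective {π = []}    {[]}     _  = refl
values-injective {π = _ ∷ _} {_ ∷ _} eq with x≡ , rest≡ ← List.∷-injective eq =
  cong₂ _∷_ (Fin.toℕ-injective x≡) (values-injective rest≡)

values-bounded : ∀ {n m} (π : Vec (Fin n) m) → All (_< n) (values π)
values-bounded []      = []
values-bounded (x ∷ π) = Fin.toℕ<n x ∷ values-bounded π

length-values : ∀ {n m} (π : Vec (Fin n) m) → length (values π) ≡ m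
length-values []      = refl
length-values (_ ∷ π) = cong suc (length-values π)

All-toList⁺ : ∀ {m} {P : ℕ → Set} (w : Vec ℕ m) → (∀ k → P (lookup w k)) → All P (toList w)
All-toList⁺ []      _ = []
All-toList⁺ (x ∷ w) h = h Fin.zero ∷ All-toList⁺ w (h ∘ Fin.suc)

All-toList⁻ : ∀ {m} {P : ℕ → Set} (w : Vec ℕ m) → All P (toList w) → ∀ k → P (lookup w k)
All-toList⁻ (x ∷ w) (px ∷ _)  Fin.zero    = px
All-toList⁻ (x ∷ w) (_  ∷ ps) (Fin.suc k) = All-toList⁻ w ps k

Unique-toList⁺ : ∀ {m} (w : Vec ℕ m) → (∀ i j → i ≢ j → lookup w i ≢ lookup w j) → Unique (toList w)
Unique-toList⁺ []      _        = []
Unique-toList⁺ (x ∷ w) distinct =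
  All-toList⁺ w (λ k → distinct Fin.zero (Fin.suc k) (λ ())) ∷
  Unique-toList⁺ w (λ i j i≢j → distinct (Fin.suc i) (Fin.suc j) (i≢j ∘ Fin.suc-injective))

Unique-toList⁻ : ∀ {m} (w : Vec ℕ m) → Unique (toList w) → ∀ i j → i ≢ j → lookup w i ≢ lookup w j
Unique-toList⁻ (x ∷ w) u        Fin.zero    Fin.zero    i≢j = ⊥-elim (i≢j refl)
Unique-toList⁻ (x ∷ w) (x∉ ∷ u) Fin.zero    (Fin.suc j) _   = All-toList⁻ w x∉ j
Unique-toList⁻ (x ∷ w) (x∉ ∷ u) (Fin.suc i) Fin.zero    _   = All-toList⁻ w x∉ i ∘ sym
Unique-toList⁻ (x ∷ w) (_  ∷ u) (Fin.suc i) (Fin.suc j) i≢j = Unique-toList⁻ w u i j (i≢j ∘ cong Fin.suc)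

module _ {n} (π : Vec (Fin n) n) where
  private
    v : Fin n → ℕ
    v i = toℕ (lookup π i)
    lookup-values : ∀ i → lookup (Vec.map toℕ π) i ≡ v i
    lookup-values i = Vec.lookup-map i toℕ π
    distinctAt : Fin n → Fin n → Bool
    distinctAt i j = (toℕ i ≡ᵇ toℕ j) ∨ not (v i ≡ᵇ v j)
    distinctAt-true : ∀ {i j} → isPerm π ≡ true → distinctAt i j ≡ true
    distinctAt-true {i} {j} h =
      all-true⁻ (distinctAt i) (all-true⁻ (λ i → all (distinctAt i) (allFin n)) h (∈.∈-allFin i)) (∈.∈-allFin j)

  isPerm-true⁻ : isPerm π ≡ true → Unique (values π)
  isPerm-true⁻ h = Unique-toList⁺ (Vec.map toℕ π) λ i j i≢j wi≡wj →
    let vi≡vj = trans (sym (lookup-values i)) (trans wi≡wj (lookup-values j))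
    in case trans (sym (distinctAt-true h))
              (cong₂ (λ a b → a ∨ not b) (≡ᵇ-false (i≢j ∘ Fin.toℕ-injective)) (≡ᵇ-true vi≡vj)) of λ ()

  isPerm-true⁺ : Unique (values π) → isPerm π ≡ true
  isPerm-true⁺ u = all-true⁺ _ (allFin n) λ {i} _ → all-true⁺ (distinctAt i) (allFin n) λ {j} _ → distinct i j
    where
    distinct : ∀ i j → distinctAt i j ≡ true
    distinct i j with i Fin.≟ j
    ... | yes refl = ∨-trueˡ _ (≡ᵇ-true {toℕ i} refl)
    ... | no  i≢j  = ∨-trueʳ _ (cong not (≡ᵇ-false λ vi≡vj →
      Unique-toList⁻ (Vec.map toℕ π) u i j i≢j (trans (lookup-values i) (trans vi≡vj (sym (lookup-values j))))))

Unique-resp-↭ : ∀ {xs ys : List ℕ} → xs ↭ ys → Unique xs → Unique ys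
Unique-resp-↭ = PermutationSetoid.Unique-resp-↭ (setoid ℕ) ∘ ↭⇒↭ₛ

IsPermutation-resp-↭ : ∀ {n xs ys} → xs ↭ ys → IsPermutation n xs → IsPermutation n ys
IsPermutation-resp-↭ xs↭ys (isPermutation u b l) =
  isPermutation (Unique-resp-↭ xs↭ys u) (↭.All-resp-↭ xs↭ys b) (trans (sym (↭.↭-length xs↭ys)) l)

IsPermutation-bound∉ : ∀ {n ℓ} → IsPermutation n ℓ → All (n ≢_) ℓ
IsPermutation-bound∉ (isPermutation _ b _) = All.map (λ x<n n≡x → <-irrefl (sym n≡x) x<n) b

IsPermutation-∷⁺ : ∀ {n ℓ} → IsPermutation n ℓ → IsPermutation (suc n) (n ∷ ℓ)
IsPermutation-∷⁺ perm@(isPermutation u b l) =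
  isPermutation (IsPermutation-bound∉ perm ∷ u) (n<1+n _ ∷ All.map m<n⇒m<1+n b) (cong suc l)

All<-suc⁻ : ∀ {n ℓ} → All (n ≢_) ℓ → All (_< suc n) ℓ → All (_< n) ℓ
All<-suc⁻ n∉ℓ ℓ<1+n = All.zipWith (λ (n≢x , x<1+n) → ≤∧≢⇒< (≤-pred x<1+n) (n≢x ∘ sym)) (n∉ℓ , ℓ<1+n)

IsPermutation-∷⁻ : ∀ {n ℓ} → IsPermutation (suc n) (n ∷ ℓ) → IsPermutation n ℓ
IsPermutation-∷⁻ (isPermutation (n∉ℓ ∷ u) (_ ∷ b) l) = isPermutation u (All<-suc⁻ n∉ℓ b) (suc-injective l)

insertMax↭ : ∀ n (xs ys : List ℕ) → xs ++ n ∷ ys ↭ n ∷ xs ++ ys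
insertMax↭ n xs ys = ↭.shift n xs ys

length≤bound : ∀ n xs → Unique xs → All (_< n) xs → length xs ≤ n
length≤bound zero    []       _ _        = z≤n
length≤bound zero    (_ ∷ _)  _ (() ∷ _)
length≤bound (suc n) xs       u xs<1+n with n ∈? xs
... | no  n∉xs = m≤n⇒m≤1+n (length≤bound n xs u (All<-suc⁻ (All.¬Any⇒All¬ xs n∉xs) xs<1+n))
... | yes n∈xs with as , bs , refl ← ∈.∈-∃++ n∈xs =
  subst (_≤ suc n) (sym (↭.↭-length shifted)) (s≤s (deleteMax (Unique-resp-↭ shifted u) (↭.All-resp-↭ shifted xs<1+n)))
  where
  shifted = insertMax↭ n as bs
  deleteMax : Unique (n ∷ as ++ bs) → All (_< suc n) (n ∷ as ++ bs) → length (as ++ bs) ≤ n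
  deleteMax (n∉ ∷ u′) (_ ∷ b′) = length≤bound n (as ++ bs) u′ (All<-suc⁻ n∉ b′)

max∈ : ∀ {n ℓ} → IsPermutation (suc n) ℓ → n ∈ ℓ
max∈ {n} {ℓ} (isPermutation u b l) with n ∈? ℓ
... | yes n∈ℓ = n∈ℓ
... | no  n∉ℓ = ⊥-elim (<-irrefl refl
  (subst (_≤ n) l (length≤bound n ℓ u (All<-suc⁻ (All.¬Any⇒All¬ ℓ n∉ℓ) b))))

laterInsertions : ℕ → List ℕ → List (List ℕ)
laterInsertions n []      = []
laterInsertions n (y ∷ ℓ) = map (y ∷_) ((n ∷ ℓ) ∷ laterInsertions n ℓ)

insertions : ℕ → List ℕ → List (List ℕ)
insertions n ℓ = (n ∷ ℓ) ∷ laterInsertions n ℓ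

insertionPerms : ℕ → List (List ℕ)
insertionPerms zero    = [] ∷ []
insertionPerms (suc n) = concatMap (insertions n) (insertionPerms n)

∈-insertions⁻ : ∀ n ℓ {z} → z ∈ insertions n ℓ → ∃₂ λ xs ys → ℓ ≡ xs ++ ys × z ≡ xs ++ n ∷ ys
∈-insertions⁻ n ℓ       (here refl) = [] , ℓ , refl , refl
∈-insertions⁻ n (y ∷ ℓ) (there z∈)
  with z′ , z′∈ , refl ← ∈.∈-map⁻ (y ∷_) z∈
  with xs , ys , refl , refl ← ∈-insertions⁻ n ℓ z′∈ = y ∷ xs , ys , refl , refl

∈-insertions⁺ : ∀ n xs ys → xs ++ n ∷ ys ∈ insertions n (xs ++ ys)
∈-insertions⁺ n []       ys = here refl
∈-insertions⁺ n (x ∷ xs) ys = there (∈.∈-map⁺ (x ∷_) (∈-insertions⁺ n xs ys))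

∈-insertions-IsPermutation : ∀ {n ℓ z} → IsPermutation n ℓ → z ∈ insertions n ℓ → IsPermutation (suc n) z
∈-insertions-IsPermutation {n} {ℓ} perm z∈ with xs , ys , refl , refl ← ∈-insertions⁻ n ℓ z∈ =
  IsPermutation-resp-↭ (↭-sym (insertMax↭ n xs ys)) (IsPermutation-∷⁺ perm)

deleteMax : ∀ {n z} → IsPermutation (suc n) z → ∃[ ℓ ] IsPermutation n ℓ × z ∈ insertions n ℓ
deleteMax {n} perm with xs , ys , refl ← ∈.∈-∃++ (max∈ perm) =
  xs ++ ys , IsPermutation-∷⁻ (IsPermutation-resp-↭ (insertMax↭ n xs ys) perm) , ∈-insertions⁺ n xs ys

insertionPerms⁻ : ∀ n {z} → z ∈ insertionPerms n → IsPermutation n z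
insertionPerms⁻ zero    (here refl) = isPermutation [] [] refl
insertionPerms⁻ (suc n) z∈ with ℓ , ℓ∈ , z∈ℓ ← find (∈.∈-concatMap⁻ (insertions n) {xs = insertionPerms n} z∈) =
  ∈-insertions-IsPermutation (insertionPerms⁻ n ℓ∈) z∈ℓ

insertionPerms⁺ : ∀ n {z} → IsPermutation n z → z ∈ insertionPerms n
insertionPerms⁺ zero    {[]} _ = here refl
insertionPerms⁺ (suc n) perm with ℓ , permℓ , z∈ ← deleteMax perm =
  ∈.∈-concatMap⁺ (insertions n) (lose (insertionPerms⁺ n permℓ) z∈)

remove : ℕ → List ℕ → List ℕ
remove n []      = []
remove n (x ∷ ℓ) = if x ≡ᵇ n then ℓ else x ∷ remove n ℓ

remove-insert : ∀ n xs ys → All (n ≢_) xs → remove n (xs ++ n ∷ ys) ≡ xs ++ ys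
remove-insert n []       ys _ rewrite ≡ᵇ-true {n} refl = refl
remove-insert n (x ∷ xs) ys (n≢x ∷ n∉xs) rewrite ≡ᵇ-false (n≢x ∘ sym) =
  cong (x ∷_) (remove-insert n xs ys n∉xs)

insertions-unique : ∀ n ℓ → All (n ≢_) ℓ → Unique (insertions n ℓ)
insertions-unique n []      _           = [] ∷ []
insertions-unique n (y ∷ ℓ) (n≢y ∷ n∉ℓ) =
  All.tabulate front≢later ∷ Unique.map⁺ List.∷-injectiveʳ (insertions-unique n ℓ n∉ℓ)
  where
  front≢later : ∀ {z} → z ∈ laterInsertions n (y ∷ ℓ) → n ∷ y ∷ ℓ ≢ z
  front≢later z∈ eq with _ , _ , refl ← ∈.∈-map⁻ (y ∷_) z∈ = n≢y (List.∷-injectiveˡ eq)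

insertionPerms-unique : ∀ n → Unique (insertionPerms n)
insertionPerms-unique zero    = [] ∷ []
insertionPerms-unique (suc n) =
  Unique-concatMap⁺ (insertions n) (remove n) removeInsertion (insertionPerms-unique n)
    (λ ℓ∈ → insertions-unique n _ (IsPermutation-bound∉ (insertionPerms⁻ n ℓ∈)))
  where
  removeInsertion : ∀ {ℓ z} → ℓ ∈ insertionPerms n → z ∈ insertions n ℓ → remove n z ≡ ℓ
  removeInsertion {ℓ} ℓ∈ z∈ with xs , ys , refl , refl ← ∈-insertions⁻ n ℓ z∈ =
    remove-insert n xs ys (All.++⁻ˡ xs (IsPermutation-bound∉ (insertionPerms⁻ n ℓ∈)))

perms-IsPermutation : ∀ {n ℓ} → ℓ ∈ map values (perms n) → IsPermutation n ℓ
perms-IsPermutation {n} ℓ∈ with π , π∈ , refl ← ∈.∈-map⁻ values ℓ∈ =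
  isPermutation (isPerm-true⁻ π (T⇒≡true (proj₂ (∈.∈-filter⁻ (T? ∘ isPerm) {xs = words (allFin n) n} π∈))))
    (values-bounded π) (length-values π)

IsPermutation-perms : ∀ {n ℓ} → IsPermutation n ℓ → ℓ ∈ map values (perms n)
IsPermutation-perms {n} (isPermutation u b l) with π , π∈ , refl ← ∈-words n _ b l =
  ∈.∈-map⁺ values (∈.∈-filter⁺ (T? ∘ isPerm) π∈ (≡true⇒T (isPerm-true⁺ π u)))

perms↭insertionPerms : ∀ n → map values (perms n) ↭ insertionPerms n
perms↭insertionPerms n = ↭-fromUniqueSameElements
  (Unique.map⁺ values-injective (Unique.filter⁺ (T? ∘ isPerm) (words-unique (Unique.allFin⁺ n) n)))
  (insertionPerms-unique n)
  (insertionPerms⁺ n ∘ perms-IsPermutation)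
  (IsPermutation-perms ∘ insertionPerms⁻ n)

-- Inserting the maximum

lastAbove : ℕ → List ℕ → Bool
lastAbove x []          = false
lastAbove x (a ∷ [])    = x <ᵇ a
lastAbove x (a ∷ b ∷ ℓ) = lastAbove x (b ∷ ℓ)

createsP : List ℕ → Bool
createsP []      = false
createsP (x ∷ ℓ) = lastAbove x ℓ ∨ createsP ℓ

createsR : ℕ → List ℕ → List ℕ → Bool
createsR n as bs = any (λ x → any (isPredAbove x n) bs) as

riseAbove-∷max : ∀ {n} x bs → All (_< n) bs → riseAbove x (n ∷ bs) ≡ riseAbove x bs
riseAbove-∷max x []            _            = refl
riseAbove-∷max {n} x (b ∷ bs)  (b<n ∷ _)    rewrite <ᵇ-false {n} (<⇒≤ b<n) | ∧-zeroʳ (x <ᵇ n) = refl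

riseAbove-max : ∀ {n} bs → All (_< n) bs → riseAbove n bs ≡ false
riseAbove-max []           _                = refl
riseAbove-max (b ∷ [])     _                = refl
riseAbove-max {n} (b ∷ c ∷ bs) (b<n ∷ c<n ∷ bs<n) =
  cong₂ _∨_ (cong (_∧ (b <ᵇ c)) (<ᵇ-false {n} (<⇒≤ b<n))) (riseAbove-max (c ∷ bs) (c<n ∷ bs<n))

riseAbove-∷-insertMax : ∀ {n} x a as bs → a < n → All (_< n) as → All (_< n) bs →
  riseAbove x (a ∷ as ++ n ∷ bs) ≡ riseAbove x (a ∷ as ++ bs) ∨ lastAbove x (a ∷ as)
riseAbove-∷-insertMax x a [] [] a<n _ _ rewrite <ᵇ-true a<n = trans (∨-identityʳ _) (∧-identityʳ _)
riseAbove-∷-insertMax x a [] (b ∷ bs) a<n _ (b<n ∷ bs<n)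
  rewrite <ᵇ-true a<n | riseAbove-∷max x (b ∷ bs) (b<n ∷ bs<n) | ∧-identityʳ (x <ᵇ a) =
  absorb (x <ᵇ a) (a <ᵇ b) (riseAbove x (b ∷ bs))
  where
  absorb : ∀ p q R → p ∨ R ≡ ((p ∧ q) ∨ R) ∨ p
  absorb true  q R = sym (∨-zeroʳ _)
  absorb false q R = sym (∨-identityʳ R)
riseAbove-∷-insertMax x a (a′ ∷ as) bs _ (a′<n ∷ as<n) bs<n
  rewrite riseAbove-∷-insertMax x a′ as bs a′<n as<n bs<n =
  sym (∨-assoc ((x <ᵇ a) ∧ (a <ᵇ a′)) (riseAbove x (a′ ∷ as ++ bs)) (lastAbove x (a′ ∷ as)))

riseAbove-insertMax : ∀ {n} x as bs → All (_< n) as → All (_< n) bs →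
  riseAbove x (as ++ n ∷ bs) ≡ riseAbove x (as ++ bs) ∨ lastAbove x as
riseAbove-insertMax x []       bs _            bs<n = trans (riseAbove-∷max x bs bs<n) (sym (∨-identityʳ _))
riseAbove-insertMax x (a ∷ as) bs (a<n ∷ as<n) bs<n = riseAbove-∷-insertMax x a as bs a<n as<n bs<n

containsP-insertMax : ∀ {n} as bs → All (_< n) as → All (_< n) bs →
  containsP (as ++ n ∷ bs) ≡ containsP (as ++ bs) ∨ createsP as
containsP-insertMax [] bs _ bs<n rewrite riseAbove-max bs bs<n = sym (∨-identityʳ _)
containsP-insertMax (a ∷ as) bs (_ ∷ as<n) bs<n
  rewrite riseAbove-insertMax a as bs as<n bs<n | containsP-insertMax as bs as<n bs<n =
  ∨-interchange (riseAbove a (as ++ bs)) (lastAbove a as) (containsP (as ++ bs)) (createsP as)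

any-++-skip : ∀ {A : Set} (f : A → Bool) xs {y} ys → f y ≡ false → any f (xs ++ y ∷ ys) ≡ any f (xs ++ ys)
any-++-skip f []       ys fy = cong (_∨ any f ys) fy
any-++-skip f (x ∷ xs) ys fy = cong (f x ∨_) (any-++-skip f xs ys fy)

inversionAbove-insertMax : ∀ {n} x as bs → All (_< n) as →
  inversionAbove x (as ++ n ∷ bs) ≡ inversionAbove x (as ++ bs) ∨ any (isPredAbove x n) bs
inversionAbove-insertMax {n} x [] bs _ = ∨-comm (any (isPredAbove x n) bs) (inversionAbove x bs)
inversionAbove-insertMax {n} x (a ∷ as) bs (a<n ∷ as<n)
  rewrite any-++-skip (isPredAbove x a) as {n} bs
            (trans (cong ((x <ᵇ n) ∧_) (≡ᵇ-false (<⇒≢ (<-trans a<n (n<1+n n)) ∘ sym))) (∧-zeroʳ _))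
        | inversionAbove-insertMax x as bs as<n =
  sym (∨-assoc (any (isPredAbove x a) (as ++ bs)) (inversionAbove x (as ++ bs)) (any (isPredAbove x n) bs))

inversionAbove-max : ∀ {n} bs → All (_< n) bs → inversionAbove n bs ≡ false
inversionAbove-max {n} []       _          = refl
inversionAbove-max {n} (b ∷ bs) (_ ∷ bs<n) =
  cong₂ _∨_ (any-false⁺ _ bs λ {v} v∈ → cong (_∧ (suc v ≡ᵇ b)) (<ᵇ-false {n} (<⇒≤ (All.lookup bs<n v∈))))
    (inversionAbove-max bs bs<n)

containsR-insertMax : ∀ {n} as bs → All (_< n) as → All (_< n) bs →
  containsR (as ++ n ∷ bs) ≡ containsR (as ++ bs) ∨ createsR n as bs
containsR-insertMax [] bs _ bs<n rewrite inversionAbove-max bs bs<n = sym (∨-identityʳ _)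
containsR-insertMax {n} (a ∷ as) bs (_ ∷ as<n) bs<n
  rewrite inversionAbove-insertMax a as bs as<n | containsR-insertMax as bs as<n bs<n =
  ∨-interchange (inversionAbove a (as ++ bs)) (any (isPredAbove a n) bs) (containsR (as ++ bs)) (createsR n as bs)

any-++ : ∀ {A : Set} (f : A → Bool) xs ys → any f (xs ++ ys) ≡ any f xs ∨ any f ys
any-++ f []       ys = refl
any-++ f (x ∷ xs) ys = trans (cong (f x ∨_) (any-++ f xs ys)) (sym (∨-assoc (f x) (any f xs) (any f ys)))

lastAbove-∷ʳ : ∀ x xs y → lastAbove x (xs ++ [ y ]) ≡ (x <ᵇ y)
lastAbove-∷ʳ x []           y = refl
lastAbove-∷ʳ x (a ∷ [])     y = refl
lastAbove-∷ʳ x (a ∷ b ∷ xs) y = lastAbove-∷ʳ x (b ∷ xs) y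

createsP-∷ʳ : ∀ xs y → createsP (xs ++ [ y ]) ≡ any (_<ᵇ y) xs
createsP-∷ʳ []       y = refl
createsP-∷ʳ (a ∷ xs) y = cong₂ _∨_ (lastAbove-∷ʳ a xs y) (createsP-∷ʳ xs y)

Unique-++-disjoint : ∀ (as bs : List ℕ) → Unique (as ++ bs) → ∀ {a b} → a ∈ as → b ∈ bs → a ≢ b
Unique-++-disjoint (x ∷ as) bs (x∉ ∷ _) (here refl) b∈ = All.lookup (All.++⁻ʳ as x∉) b∈
Unique-++-disjoint (x ∷ as) bs (_ ∷ u)  (there a∈)  b∈ = Unique-++-disjoint as bs u a∈ b∈

createsR-IsPermutation : ∀ M P bs {a} → a ∈ P → IsPermutation (suc M) (P ++ bs) →
  createsR (suc M) P bs ≡ not (any (_≡ᵇ M) P)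
createsR-IsPermutation M P bs {a} a∈P perm@(isPermutation u b _) with ∈.∈-++⁻ P (max∈ perm)
... | inj₁ M∈P rewrite any-true⁺ (_≡ᵇ M) M∈P (≡ᵇ-true {M} refl) =
  any-false⁺ _ P λ {x} _ → any-false⁺ _ bs λ {v} v∈bs →
    trans (cong ((x <ᵇ v) ∧_) (≡ᵇ-false (Unique-++-disjoint P bs u M∈P v∈bs ∘ suc-injective ∘ sym))) (∧-zeroʳ _)
... | inj₂ M∈bs rewrite any-false⁺ (_≡ᵇ M) P (λ x∈P → ≡ᵇ-false (Unique-++-disjoint P bs u x∈P M∈bs)) =
  any-true⁺ _ a∈P (any-true⁺ _ M∈bs (cong₂ _∧_ (<ᵇ-true a<M) (≡ᵇ-true {suc M} refl)))
  where
  a<M : a < M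
  a<M = ≤∧≢⇒< (≤-pred (All.lookup (All.++⁻ˡ P b) a∈P)) (Unique-++-disjoint P bs u a∈P M∈bs)

avoidsPR-split : ∀ ℓ → avoidsPR ℓ ≡ true → containsP ℓ ≡ false × containsR ℓ ≡ false
avoidsPR-split ℓ h with containsP ℓ | containsR ℓ | h
... | false | false | _ = refl , refl

avoidsPR-insertMax : ∀ M P r → P ≢ [] → IsPermutation (suc M) (P ++ r) → avoidsPR (P ++ r) ≡ true →
  avoidsPR (P ++ suc M ∷ r) ≡ not (createsP P) ∧ any (_≡ᵇ M) P
avoidsPR-insertMax M []      r P≢[] _    _  = ⊥-elim (P≢[] refl)
avoidsPR-insertMax M P@(a ∷ _) r _  perm av
  with P<n , r<n ← All.++⁻ P (IsPermutation.bounded perm)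
  with noP , noR ← avoidsPR-split (P ++ r) av = trans
    (cong₂ (λ X Y → not X ∧ not Y)
      (trans (containsP-insertMax P r P<n r<n) (cong (_∨ createsP P) noP))
      (trans (containsR-insertMax P r P<n r<n)
        (trans (cong (_∨ createsR (suc M) P r) noR) (createsR-IsPermutation M P r (here refl) perm))))
    (cong (not (createsP P) ∧_) (not-involutive (any (_≡ᵇ M) P)))

-- The generating tree

minimaBelow : ℕ → List ℕ → ℕ
minimaBelow c []      = 0
minimaBelow c (x ∷ ℓ) = if c <ᵇ x then minimaBelow c ℓ else suc (minimaBelow x ℓ)

minimaAfter : ℕ → ℕ → List ℕ → ℕ
minimaAfter M c []      = 0
minimaAfter M c (x ∷ ℓ) = if x ≡ᵇ M then minimaBelow c (x ∷ ℓ) else minimaAfter M (c ⊓ x) ℓ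

Label : Set
Label = ℕ × ℕ

-- (number of left-to-right minima, number of those not to the left of the maximum)
label : List ℕ → Label
label ℓ = minimaBelow (length ℓ) ℓ , minimaAfter (length ℓ ∸ 1) (length ℓ) ℓ

children : Label → List Label
children (L , m) = (suc L , suc L) ∷ map (L ,_) (downFrom m)

runningMin : ℕ → List ℕ → ℕ
runningMin = foldl _⊓_

-- Scanning ℓ with the running minimum c of the prefix and whether the old maximum M has been
-- seen, the new maximum may go directly after y iff y is below c and M occurs at or before y;
-- the second label of that insertion is the number of left-to-right minima of the rest below y.
slotLabels : ℕ → ℕ → Bool → List ℕ → List ℕ
slotLabels M c seen []      = []
slotLabels M c seen (y ∷ ℓ) =
  if not (c <ᵇ y) ∧ seen′ then minimaBelow (c ⊓ y) ℓ ∷ rest else rest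
  where
  seen′ = seen ∨ (y ≡ᵇ M)
  rest  = slotLabels M (c ⊓ y) seen′ ℓ

slotLabels-seen : ∀ M c ℓ → slotLabels M c true ℓ ≡ downFrom (minimaBelow c ℓ)
slotLabels-seen M c []      = refl
slotLabels-seen M c (y ∷ ℓ) with c <ᵇ y in c<y
... | true  = trans (cong (λ c′ → slotLabels M c′ true ℓ) (m≤n⇒m⊓n≡m (<⇒≤ (<ᵇ-true⁻ c<y))))
                    (slotLabels-seen M c ℓ)
... | false = trans (cong (λ c′ → minimaBelow c′ ℓ ∷ slotLabels M c′ true ℓ) (m≥n⇒m⊓n≡n (<ᵇ-false⁻ c<y)))
                    (cong (minimaBelow y ℓ ∷_) (slotLabels-seen M y ℓ))

slotLabels-unseen : ∀ M c ℓ → slotLabels M c false ℓ ≡ downFrom (minimaAfter M c ℓ)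
slotLabels-unseen M c []      = refl
slotLabels-unseen M c (y ∷ ℓ) with y ≡ᵇ M
... | true  = slotLabels-seen M c (y ∷ ℓ)
... | false rewrite ∧-zeroʳ (not (c <ᵇ y)) = slotLabels-unseen M (c ⊓ y) ℓ

label-length : ∀ ℓ {k} → length ℓ ≡ k → label ℓ ≡ (minimaBelow k ℓ , minimaAfter (k ∸ 1) k ℓ)
label-length ℓ refl = refl

minimaBelow-insertMax : ∀ {n} c as bs → c < n → All (_< n) as →
  minimaBelow c (as ++ n ∷ bs) ≡ minimaBelow c (as ++ bs)
minimaBelow-insertMax c []       bs c<n _ rewrite <ᵇ-true c<n = refl
minimaBelow-insertMax c (a ∷ as) bs c<n (a<n ∷ as<n) with c <ᵇ a
... | true  = minimaBelow-insertMax c as bs c<n as<n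
... | false = cong suc (minimaBelow-insertMax a as bs a<n as<n)

runningMin≤ : ∀ c xs → runningMin c xs ≤ c
runningMin≤ c []       = ≤-refl
runningMin≤ c (a ∷ xs) = ≤-trans (runningMin≤ (c ⊓ a) xs) (m⊓n≤m c a)

minimaAfter-++ : ∀ M c as rest → All (M ≢_) as → minimaAfter M c (as ++ rest) ≡ minimaAfter M (runningMin c as) rest
minimaAfter-++ M c []       rest _            = refl
minimaAfter-++ M c (a ∷ as) rest (M≢a ∷ M∉as) rewrite ≡ᵇ-false (M≢a ∘ sym) = minimaAfter-++ M (c ⊓ a) as rest M∉as

label-insertMax : ∀ n P r → P ≢ [] → IsPermutation n (P ++ r) →
  label (P ++ n ∷ r) ≡ (minimaBelow n (P ++ r) , minimaBelow (runningMin n P) r)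
label-insertMax n []      r P≢[] _ = ⊥-elim (P≢[] refl)
label-insertMax n (a ∷ t) r _    perm@(isPermutation _ bounded l)
  with a<n ∷ t<n , _ ← All.++⁻ (a ∷ t) bounded =
  trans (label-length ((a ∷ t) ++ n ∷ r) (trans (↭.↭-length (insertMax↭ n (a ∷ t) r)) (cong suc l)))
        (cong₂ _,_ minimaBelow≡ minimaAfter≡)
  where
  minimaBelow≡ : minimaBelow (suc n) (a ∷ t ++ n ∷ r) ≡ minimaBelow n (a ∷ t ++ r)
  minimaBelow≡ rewrite <ᵇ-false {suc n} {a} (m≤n⇒m≤1+n (<⇒≤ a<n)) | <ᵇ-false {n} {a} (<⇒≤ a<n) =
    cong suc (minimaBelow-insertMax a t r a<n t<n)
  minimaAfter≡ : minimaAfter n (suc n) (a ∷ t ++ n ∷ r) ≡ minimaBelow (runningMin n (a ∷ t)) r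
  minimaAfter≡ rewrite ≡ᵇ-false {a} {n} (<⇒≢ a<n)
    | m≥n⇒m⊓n≡n (m≤n⇒m≤1+n (<⇒≤ a<n)) | m≥n⇒m⊓n≡n (<⇒≤ a<n)
    | minimaAfter-++ n a t (n ∷ r) (All.map (λ x<n → <⇒≢ x<n ∘ sym) t<n)
    | ≡ᵇ-true {n} refl | <ᵇ-true (≤-<-trans (runningMin≤ a t) a<n) = refl

label-∷max : ∀ n ℓ → length ℓ ≡ n → label (n ∷ ℓ) ≡ (suc (minimaBelow n ℓ) , suc (minimaBelow n ℓ))
label-∷max n ℓ l = trans (label-length (n ∷ ℓ) (cong suc l)) (cong₂ _,_ minimaBelow≡ minimaAfter≡)
  where
  minimaBelow≡ : minimaBelow (suc n) (n ∷ ℓ) ≡ suc (minimaBelow n ℓ)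
  minimaBelow≡ rewrite <ᵇ-false {suc n} {n} (n≤1+n n) = refl
  minimaAfter≡ : minimaAfter n (suc n) (n ∷ ℓ) ≡ suc (minimaBelow n ℓ)
  minimaAfter≡ rewrite ≡ᵇ-true {n} refl = minimaBelow≡

avoidsPR-∷max : ∀ n ℓ → IsPermutation n ℓ → avoidsPR ℓ ≡ true → avoidsPR (n ∷ ℓ) ≡ true
avoidsPR-∷max n ℓ perm av with noP , noR ← avoidsPR-split ℓ av =
  cong₂ (λ X Y → not X ∧ not Y)
    (trans (containsP-insertMax [] ℓ [] (IsPermutation.bounded perm)) (trans (∨-identityʳ _) noP))
    (trans (containsR-insertMax [] ℓ [] (IsPermutation.bounded perm)) (trans (∨-identityʳ _) noR))

⊓-<ᵇ : ∀ c a y → ((c ⊓ a) <ᵇ y) ≡ (c <ᵇ y) ∨ (a <ᵇ y)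
⊓-<ᵇ c a y with ≤-total c a
... | inj₁ c≤a rewrite m≤n⇒m⊓n≡m c≤a with c <ᵇ y in c<y
...   | true  = refl
...   | false = sym (<ᵇ-false {a} {y} (≤-trans (<ᵇ-false⁻ c<y) c≤a))
⊓-<ᵇ c a y | inj₂ a≤c rewrite m≥n⇒m⊓n≡n a≤c with a <ᵇ y in a<y
...   | true  = sym (∨-zeroʳ _)
...   | false = trans (sym (<ᵇ-false {c} {y} (≤-trans (<ᵇ-false⁻ a<y) a≤c))) (sym (∨-identityʳ _))

runningMin-<ᵇ : ∀ c xs y → (runningMin c xs <ᵇ y) ≡ (c <ᵇ y) ∨ any (_<ᵇ y) xs
runningMin-<ᵇ c []       y = sym (∨-identityʳ _)
runningMin-<ᵇ c (a ∷ xs) y rewrite runningMin-<ᵇ (c ⊓ a) xs y | ⊓-<ᵇ c a y = ∨-assoc (c <ᵇ y) (a <ᵇ y) _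

admissibleSlot : ∀ n M xs y → y < n →
  not (createsP (xs ++ [ y ])) ∧ any (_≡ᵇ M) (xs ++ [ y ]) ≡
  not (runningMin n xs <ᵇ y) ∧ (any (_≡ᵇ M) xs ∨ (y ≡ᵇ M))
admissibleSlot n M xs y y<n rewrite createsP-∷ʳ xs y | runningMin-<ᵇ n xs y | <ᵇ-false {n} {y} (<⇒≤ y<n)
  | any-++ (_≡ᵇ M) xs [ y ] | ∨-identityʳ (y ≡ᵇ M) = refl

filterᵇ-∷ : ∀ {A : Set} (f : A → Bool) x xs → filterᵇ f (x ∷ xs) ≡ (if f x then x ∷ filterᵇ f xs else filterᵇ f xs)
filterᵇ-∷ f x xs with f x
... | true  = refl
... | false = refl

map-++-laterInsertions : ∀ n xs y r → map (xs ++_) (laterInsertions n (y ∷ r)) ≡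
  ((xs ++ [ y ]) ++ n ∷ r) ∷ map ((xs ++ [ y ]) ++_) (laterInsertions n r)
map-++-laterInsertions n xs y r = cong₂ _∷_ (sym (List.++-assoc xs [ y ] (n ∷ r)))
  (trans (sym (List.map-∘ (laterInsertions n r))) (List.map-cong (sym ∘ List.++-assoc xs [ y ]) (laterInsertions n r)))

laterInsertions-labels : ∀ n ℓ → IsPermutation n ℓ → avoidsPR ℓ ≡ true → ∀ xs r → xs ++ r ≡ ℓ →
  map label (filterᵇ avoidsPR (map (xs ++_) (laterInsertions n r))) ≡
  map (minimaBelow n ℓ ,_) (slotLabels (n ∸ 1) (runningMin n xs) (any (_≡ᵇ n ∸ 1) xs) r)
laterInsertions-labels n ℓ perm av xs [] eq = refl
laterInsertions-labels zero ℓ perm av xs (y ∷ r) eq =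
  ⊥-elim (n≮0 (All.lookup (IsPermutation.bounded perm) (subst (y ∈_) eq (∈.∈-++⁺ʳ xs (here refl)))))
laterInsertions-labels n@(suc M) ℓ perm av xs (y ∷ r) eq = slots
  where
  L = minimaBelow n ℓ
  P = xs ++ [ y ]
  P++r≡ℓ : P ++ r ≡ ℓ
  P++r≡ℓ = trans (List.++-assoc xs [ y ] r) eq
  permP : IsPermutation n (P ++ r)
  permP = subst (IsPermutation n) (sym P++r≡ℓ) perm
  P≢[] : P ≢ []
  P≢[] P≡[] = case List.++-conicalʳ xs [ y ] P≡[] of λ ()
  y<n : y < n
  y<n = All.lookup (IsPermutation.bounded perm) (subst (y ∈_) eq (∈.∈-++⁺ʳ xs (here refl)))
  labelHere : label (P ++ n ∷ r) ≡ (L , minimaBelow (runningMin n xs ⊓ y) r)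
  labelHere = trans (label-insertMax n P r P≢[] permP)
    (cong₂ _,_ (cong (minimaBelow n) P++r≡ℓ) (cong (λ c → minimaBelow c r) (List.foldl-++ _⊓_ n xs [ y ])))
  avoidsHere : avoidsPR (P ++ n ∷ r) ≡ not (runningMin n xs <ᵇ y) ∧ (any (_≡ᵇ M) xs ∨ (y ≡ᵇ M))
  avoidsHere = trans (avoidsPR-insertMax M P r P≢[] permP (subst (λ z → avoidsPR z ≡ true) (sym P++r≡ℓ) av))
                     (admissibleSlot n M xs y y<n)
  later : map label (filterᵇ avoidsPR (map (P ++_) (laterInsertions n r))) ≡
          map (L ,_) (slotLabels M (runningMin n xs ⊓ y) (any (_≡ᵇ M) xs ∨ (y ≡ᵇ M)) r)
  later = trans (laterInsertions-labels n ℓ perm av P r P++r≡ℓ)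
    (cong₂ (λ c seen → map (L ,_) (slotLabels M c seen r)) (List.foldl-++ _⊓_ n xs [ y ])
      (trans (any-++ (_≡ᵇ M) xs [ y ]) (cong (any (_≡ᵇ M) xs ∨_) (∨-identityʳ (y ≡ᵇ M)))))
  admissible = not (runningMin n xs <ᵇ y) ∧ (any (_≡ᵇ M) xs ∨ (y ≡ᵇ M))
  F = filterᵇ avoidsPR (map (P ++_) (laterInsertions n r))
  choose : ∀ b → map label (if b then (P ++ n ∷ r) ∷ F else F) ≡
    map (L ,_) (if b then minimaBelow (runningMin n xs ⊓ y) r ∷ slotLabels M (runningMin n xs ⊓ y) (any (_≡ᵇ M) xs ∨ (y ≡ᵇ M)) r
                     else slotLabels M (runningMin n xs ⊓ y) (any (_≡ᵇ M) xs ∨ (y ≡ᵇ M)) r)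
  choose true  = cong₂ _∷_ labelHere later
  choose false = later
  slots : map label (filterᵇ avoidsPR (map (xs ++_) (laterInsertions n (y ∷ r)))) ≡
          map (L ,_) (slotLabels M (runningMin n xs) (any (_≡ᵇ M) xs) (y ∷ r))
  slots = begin
    map label (filterᵇ avoidsPR (map (xs ++_) (laterInsertions n (y ∷ r))))
      ≡⟨ cong (map label ∘ filterᵇ avoidsPR) (map-++-laterInsertions n xs y r) ⟩
    map label (filterᵇ avoidsPR ((P ++ n ∷ r) ∷ map (P ++_) (laterInsertions n r)))
      ≡⟨ cong (map label) (filterᵇ-∷ avoidsPR (P ++ n ∷ r) (map (P ++_) (laterInsertions n r))) ⟩
    map label (if avoidsPR (P ++ n ∷ r) then (P ++ n ∷ r) ∷ F else F)
      ≡⟨ cong (λ b → map label (if b then (P ++ n ∷ r) ∷ F else F)) avoidsHere ⟩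
    map label (if admissible then (P ++ n ∷ r) ∷ F else F)
      ≡⟨ choose admissible ⟩
    map (L ,_) (slotLabels M (runningMin n xs) (any (_≡ᵇ M) xs) (y ∷ r)) ∎

avoidingInsertions-labels : ∀ n ℓ → IsPermutation n ℓ → avoidsPR ℓ ≡ true →
  map label (filterᵇ avoidsPR (insertions n ℓ)) ≡ children (label ℓ)
avoidingInsertions-labels n ℓ perm av = begin
  map label (filterᵇ avoidsPR ((n ∷ ℓ) ∷ laterInsertions n ℓ))
    ≡⟨ cong (map label) (filterᵇ-∷ avoidsPR (n ∷ ℓ) (laterInsertions n ℓ)) ⟩
  map label (if avoidsPR (n ∷ ℓ) then (n ∷ ℓ) ∷ F else F)
    ≡⟨ cong (λ b → map label (if b then (n ∷ ℓ) ∷ F else F)) (avoidsPR-∷max n ℓ perm av) ⟩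
  label (n ∷ ℓ) ∷ map label F
    ≡⟨ cong₂ _∷_ (label-∷max n ℓ (IsPermutation.length≡ perm)) later ⟩
  (suc L , suc L) ∷ map (L ,_) (downFrom (minimaAfter (n ∸ 1) n ℓ))
    ≡⟨ cong children (sym (label-length ℓ (IsPermutation.length≡ perm))) ⟩
  children (label ℓ) ∎
  where
  F = filterᵇ avoidsPR (laterInsertions n ℓ)
  L = minimaBelow n ℓ
  later : map label F ≡ map (L ,_) (downFrom (minimaAfter (n ∸ 1) n ℓ))
  later = begin
    map label F
      ≡⟨ cong (map label ∘ filterᵇ avoidsPR) (sym (List.map-id (laterInsertions n ℓ))) ⟩
    map label (filterᵇ avoidsPR (map ([] ++_) (laterInsertions n ℓ)))
      ≡⟨ laterInsertions-labels n ℓ perm av [] ℓ refl ⟩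
    map (L ,_) (slotLabels (n ∸ 1) n false ℓ)
      ≡⟨ cong (map (L ,_)) (slotLabels-unseen (n ∸ 1) n ℓ) ⟩
    map (L ,_) (downFrom (minimaAfter (n ∸ 1) n ℓ)) ∎

insertions-containing : ∀ n ℓ → IsPermutation n ℓ → avoidsPR ℓ ≡ false →
  filterᵇ avoidsPR (insertions n ℓ) ≡ []
insertions-containing n ℓ perm contains = List.filter-none (T? ∘ avoidsPR) (All.tabulate notAvoiding)
  where
  stillContains : ∀ a b c d → not a ∧ not b ≡ false → not (a ∨ c) ∧ not (b ∨ d) ≡ false
  stillContains true  b     c d _ = refl
  stillContains false true  c d _ = ∧-zeroʳ _
  notAvoiding : ∀ {z} → z ∈ insertions n ℓ → ¬ T (avoidsPR z)
  notAvoiding z∈ with xs , ys , refl , refl ← ∈-insertions⁻ n ℓ z∈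
                 with xs<n , ys<n ← All.++⁻ xs (IsPermutation.bounded perm) =
    subst T (trans (cong₂ (λ X Y → not X ∧ not Y) (containsP-insertMax xs ys xs<n ys<n) (containsR-insertMax xs ys xs<n ys<n))
      (stillContains (containsP (xs ++ ys)) (containsR (xs ++ ys)) (createsP xs) (createsR n xs ys) contains))

filterᵇ-concatMap : ∀ {A B : Set} (f : B → Bool) (g : A → List B) xs →
  filterᵇ f (concatMap g xs) ≡ concatMap (filterᵇ f ∘ g) xs
filterᵇ-concatMap f g []       = refl
filterᵇ-concatMap f g (x ∷ xs) = trans (List.filter-++ (T? ∘ f) (g x) (concatMap g xs))
  (cong (filterᵇ f (g x) ++_) (filterᵇ-concatMap f g xs))

concatMap-filterᵇ : ∀ {A B : Set} (f : A → Bool) (g : A → List B) xs →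
  (∀ {x} → x ∈ xs → f x ≡ false → g x ≡ []) → concatMap g xs ≡ concatMap g (filterᵇ f xs)
concatMap-filterᵇ f g []       _     = refl
concatMap-filterᵇ f g (x ∷ xs) empty with f x in fx
... | true  = cong (g x ++_) (concatMap-filterᵇ f g xs (empty ∘ there))
... | false rewrite empty (here refl) fx = concatMap-filterᵇ f g xs (empty ∘ there)

level : ℕ → List Label
level zero    = (0 , 0) ∷ []
level (suc n) = concatMap children (level n)

avoiders-labels : ∀ n → map label (filterᵇ avoidsPR (insertionPerms n)) ≡ level n
avoiders-labels zero    = refl
avoiders-labels (suc n) = begin
  map label (filterᵇ avoidsPR (concatMap (insertions n) (insertionPerms n)))
    ≡⟨ cong (map label) (filterᵇ-concatMap avoidsPR (insertions n) (insertionPerms n)) ⟩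
  map label (concatMap avoidingInsertions (insertionPerms n))
    ≡⟨ cong (map label) (concatMap-filterᵇ avoidsPR avoidingInsertions (insertionPerms n)
          (λ ℓ∈ → insertions-containing n _ (insertionPerms⁻ n ℓ∈))) ⟩
  map label (concatMap avoidingInsertions avoiders)
    ≡⟨ List.map-concatMap label avoidingInsertions avoiders ⟩
  concat (map (map label ∘ avoidingInsertions) avoiders)
    ≡⟨ cong concat (List.map-cong-local (All.tabulate childLabels)) ⟩
  concat (map (children ∘ label) avoiders)
    ≡⟨ List.concatMap-map children label avoiders ⟨
  concatMap children (map label avoiders)
    ≡⟨ cong (concatMap children) (avoiders-labels n) ⟩
  level (suc n) ∎
  where
  avoidingInsertions = filterᵇ avoidsPR ∘ insertions n
  avoiders = filterᵇ avoidsPR (insertionPerms n)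
  childLabels : ∀ {ℓ} → ℓ ∈ avoiders → map label (avoidingInsertions ℓ) ≡ children (label ℓ)
  childLabels ℓ∈ with ℓ∈′ , av ← ∈.∈-filter⁻ (T? ∘ avoidsPR) {xs = insertionPerms n} ℓ∈ =
    avoidingInsertions-labels n _ (insertionPerms⁻ n ℓ∈′) (T⇒≡true av)

-- Counting the generating tree

descendants : ℕ → Label → ℕ
descendants zero    _ = 1
descendants (suc t) x = sum (map (descendants t) (children x))

sum-map-concatMap : ∀ {A B : Set} (f : B → ℕ) (g : A → List B) xs →
  sum (map f (concatMap g xs)) ≡ sum (map (sum ∘ map f ∘ g) xs)
sum-map-concatMap f g []       = refl
sum-map-concatMap f g (x ∷ xs) = begin
  sum (map f (g x ++ concatMap g xs))              ≡⟨ cong sum (List.map-++ f (g x) (concatMap g xs)) ⟩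
  sum (map f (g x) ++ map f (concatMap g xs))      ≡⟨ sum-++ (map f (g x)) (map f (concatMap g xs)) ⟩
  sum (map f (g x)) + sum (map f (concatMap g xs)) ≡⟨ cong (sum (map f (g x)) +_) (sum-map-concatMap f g xs) ⟩
  sum (map (sum ∘ map f ∘ g) (x ∷ xs))             ∎

level-descendants : ∀ n t → sum (map (descendants t) (level n)) ≡ descendants (n + t) (0 , 0)
level-descendants zero    t = +-identityʳ _
level-descendants (suc n) t = begin
  sum (map (descendants t) (concatMap children (level n))) ≡⟨ sum-map-concatMap (descendants t) children (level n) ⟩
  sum (map (descendants (suc t)) (level n))                ≡⟨ level-descendants n (suc t) ⟩
  descendants (n + suc t) (0 , 0)                          ≡⟨ cong (λ k → descendants k (0 , 0)) (+-suc n t) ⟩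
  descendants (suc n + t) (0 , 0)                          ∎

length≡sum-map-1 : ∀ {A : Set} (xs : List A) → length xs ≡ sum (map (λ _ → 1) xs)
length≡sum-map-1 []       = refl
length≡sum-map-1 (_ ∷ xs) = cong suc (length≡sum-map-1 xs)

length-level : ∀ n → length (level n) ≡ descendants n (0 , 0)
length-level n = trans (length≡sum-map-1 (level n))
  (trans (level-descendants n 0) (cong (λ k → descendants k (0 , 0)) (+-identityʳ n)))

antidiagonalSum : ℕ → (ℕ → ℕ → ℕ) → ℕ
antidiagonalSum zero    f = f 0 0
antidiagonalSum (suc t) f = f 0 (suc t) + antidiagonalSum t (f ∘ suc)

previousAntidiagonalSum : ℕ → (ℕ → ℕ → ℕ) → ℕ
previousAntidiagonalSum zero    f = 0
previousAntidiagonalSum (suc t) f = antidiagonalSum t f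

previousAntidiagonalSum-suc : ∀ t f →
  previousAntidiagonalSum (suc t) f ≡ f 0 t + previousAntidiagonalSum t (f ∘ suc)
previousAntidiagonalSum-suc zero    f = sym (+-identityʳ _)
previousAntidiagonalSum-suc (suc t) f = refl

sum-map-+ : ∀ (f g : ℕ → ℕ) xs → sum (map (λ j → f j + g j) xs) ≡ sum (map f xs) + sum (map g xs)
sum-map-+ f g []       = refl
sum-map-+ f g (x ∷ xs) rewrite sum-map-+ f g xs = +-interchange (f x) (g x) (sum (map f xs)) (sum (map g xs))

hockeyStick : ∀ m a k → (m + a) C suc k ≡ a C suc k + sum (map (λ j → (j + a) C k) (downFrom m))
hockeyStick zero    a k = sym (+-identityʳ _)
hockeyStick (suc m) a k = begin
  suc (m + a) C suc k                                               ≡⟨ nCk+nC[k+1]≡[n+1]C[k+1] (m + a) k ⟨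
  (m + a) C k + (m + a) C suc k                                     ≡⟨ cong ((m + a) C k +_) (hockeyStick m a k) ⟩
  (m + a) C k + (a C suc k + sum (map (λ j → (j + a) C k) (downFrom m))) ≡⟨ +-leftComm ((m + a) C k) (a C suc k) _ ⟩
  a C suc k + sum (map (λ j → (j + a) C k) (downFrom (suc m)))      ∎

sum-map-0 : ∀ (xs : List ℕ) → sum (map (λ _ → 0) xs) ≡ 0
sum-map-0 []       = refl
sum-map-0 (_ ∷ xs) = sum-map-0 xs

antidiagonal-hockeyStick : ∀ t (a : ℕ → ℕ) m →
  antidiagonalSum t (λ d k → (m + a d) C k) ≡
  antidiagonalSum t (λ d k → a d C k) + sum (map (λ j → previousAntidiagonalSum t (λ d k → (j + a d) C k)) (downFrom m))
antidiagonal-hockeyStick zero    a m = cong suc (sym (sum-map-0 (downFrom m)))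
antidiagonal-hockeyStick (suc t) a m = begin
  (m + a 0) C suc t + antidiagonalSum t (λ d k → (m + a (suc d)) C k)
    ≡⟨ cong₂ _+_ (hockeyStick m (a 0) t) (antidiagonal-hockeyStick t (a ∘ suc) m) ⟩
  (a 0 C suc t + X) + (antidiagonalSum t (λ d k → a (suc d) C k) + Y)
    ≡⟨ +-interchange (a 0 C suc t) X (antidiagonalSum t (λ d k → a (suc d) C k)) Y ⟩
  antidiagonalSum (suc t) (λ d k → a d C k) + (X + Y)
    ≡⟨ cong (antidiagonalSum (suc t) (λ d k → a d C k) +_) (sym (begin
         sum (map (λ j → previousAntidiagonalSum (suc t) (λ d k → (j + a d) C k)) (downFrom m))
           ≡⟨ cong sum (List.map-cong (λ j → previousAntidiagonalSum-suc t (λ d k → (j + a d) C k)) (downFrom m)) ⟩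
         sum (map (λ j → (j + a 0) C t + previousAntidiagonalSum t (λ d k → (j + a (suc d)) C k)) (downFrom m))
           ≡⟨ sum-map-+ (λ j → (j + a 0) C t) (λ j → previousAntidiagonalSum t (λ d k → (j + a (suc d)) C k)) (downFrom m) ⟩
         X + Y ∎)) ⟩
  antidiagonalSum (suc t) (λ d k → a d C k) +
    sum (map (λ j → previousAntidiagonalSum (suc t) (λ d k → (j + a d) C k)) (downFrom m)) ∎
  where
  X = sum (map (λ j → (j + a 0) C t) (downFrom m))
  Y = sum (map (λ j → previousAntidiagonalSum t (λ d k → (j + a (suc d)) C k)) (downFrom m))

triangle : ℕ → ℕ → ℕ
triangle L zero    = 0
triangle L (suc d) = suc L + triangle (suc L) d

descendants-closedForm : ∀ t L m → descendants t (L , m) ≡ antidiagonalSum t (λ d k → (m + triangle L d) C k)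
descendants-closedForm zero    L m = refl
descendants-closedForm (suc t) L m = begin
  descendants t (suc L , suc L) + sum (map (descendants t) (map (L ,_) (downFrom m)))
    ≡⟨ cong₂ _+_ (descendants-closedForm t (suc L) (suc L))
         (cong sum (trans (sym (List.map-∘ (downFrom m))) (List.map-cong (descendants-closedForm t L) (downFrom m)))) ⟩
  antidiagonalSum (suc t) (λ d k → triangle L d C k) +
    sum (map (λ j → previousAntidiagonalSum (suc t) (λ d k → (j + triangle L d) C k)) (downFrom m))
    ≡⟨ antidiagonal-hockeyStick (suc t) (triangle L) m ⟨
  antidiagonalSum (suc t) (λ d k → (m + triangle L d) C k) ∎

triangle-suc : ∀ L d → triangle (suc L) d ≡ d + triangle L d
triangle-suc L zero    = refl
triangle-suc L (suc d) rewrite triangle-suc (suc L) d = rearrange L d (triangle (suc L) d)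
  where
  rearrange : ∀ L d T → suc (suc L) + (d + T) ≡ suc d + (suc L + T)
  rearrange = solve-∀

triangle-zero : ∀ d → triangle 0 d ≡ suc d C 2
triangle-zero zero    = refl
triangle-zero (suc d) = begin
  suc (triangle 1 d)         ≡⟨ cong suc (triangle-suc 0 d) ⟩
  suc d + triangle 0 d       ≡⟨ cong₂ _+_ (nC1≡n (suc d)) (sym (triangle-zero d)) ⟨
  suc d C 1 + suc d C 2      ≡⟨ nCk+nC[k+1]≡[n+1]C[k+1] (suc d) 1 ⟩
  suc (suc d) C 2            ∎

antidiagonalSum≡sum-applyUpTo : ∀ t f → antidiagonalSum t f ≡ sum (applyUpTo (λ d → f d (t ∸ d)) (suc t))
antidiagonalSum≡sum-applyUpTo zero    f = sym (+-identityʳ _)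
antidiagonalSum≡sum-applyUpTo (suc t) f = cong (f 0 (suc t) +_) (antidiagonalSum≡sum-applyUpTo t (f ∘ suc))

map-applyUpTo : ∀ {A B : Set} (g : A → B) (h : ℕ → A) n → map g (applyUpTo h n) ≡ applyUpTo (g ∘ h) n
map-applyUpTo g h zero    = refl
map-applyUpTo g h (suc n) = cong (g (h 0) ∷_) (map-applyUpTo g (h ∘ suc) n)

rhs≡descendants : ∀ n → rhs n ≡ descendants n (0 , 0)
rhs≡descendants n = begin
  sum (map (λ k → suc k C 2 C (n ∸ k)) (upTo (suc n)))
    ≡⟨ cong sum (List.map-cong (λ k → cong (_C (n ∸ k)) (triangle-zero k)) (upTo (suc n))) ⟨
  sum (map (λ k → triangle 0 k C (n ∸ k)) (upTo (suc n)))
    ≡⟨ cong sum (map-applyUpTo (λ k → triangle 0 k C (n ∸ k)) (λ k → k) (suc n)) ⟩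
  sum (applyUpTo (λ k → triangle 0 k C (n ∸ k)) (suc n))
    ≡⟨ antidiagonalSum≡sum-applyUpTo n (λ d k → triangle 0 d C k) ⟨
  antidiagonalSum n (λ d k → triangle 0 d C k)
    ≡⟨ descendants-closedForm n 0 0 ⟨
  descendants n (0 , 0) ∎

length-filterᵇ-map : ∀ {A B : Set} (f : A → Bool) (h : B → Bool) (g : A → B) → (∀ x → f x ≡ h (g x)) →
  ∀ xs → length (filterᵇ f xs) ≡ length (filterᵇ h (map g xs))
length-filterᵇ-map f h g f≡h∘g []       = refl
length-filterᵇ-map f h g f≡h∘g (x ∷ xs)
  rewrite filterᵇ-∷ f x xs | filterᵇ-∷ h (g x) (map g xs) | f≡h∘g x with h (g x)
... | true  = cong suc (length-filterᵇ-map f h g f≡h∘g xs)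
... | false = length-filterᵇ-map f h g f≡h∘g xs

proposition13 : (n : ℕ) → length (Av n (p ∷ r ∷ [])) ≡ rhs n
proposition13 n = begin
  length (filterᵇ (λ π → avoidsAll π (p ∷ r ∷ [])) (perms n))
    ≡⟨ length-filterᵇ-map _ avoidsPR values avoidsAll≡avoidsPR (perms n) ⟩
  length (filterᵇ avoidsPR (map values (perms n)))
    ≡⟨ ↭.↭-length (↭.filter-↭ (T? ∘ avoidsPR) (perms↭insertionPerms n)) ⟩
  length (filterᵇ avoidsPR (insertionPerms n))
    ≡⟨ List.length-map label (filterᵇ avoidsPR (insertionPerms n)) ⟨
  length (map label (filterᵇ avoidsPR (insertionPerms n)))
    ≡⟨ cong length (avoiders-labels n) ⟩
  length (level n)
    ≡⟨ length-level n ⟩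
  descendants n (0 , 0)
    ≡⟨ rhs≡descendants n ⟨
  rhs n ∎
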